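{- Let $G_i\leq\mathrm{Sym}(n_i)$, $1\leq i\leq k$, be permutation groups and let $G=G_1\times\cdots\times G_k$ be their external direct product acting on $\Omega=[n_1]\times\cdots\times[n_k]$ by $(x_1,\dots,x_k)^{(g_1,\dots,g_k)}=(x_1^{g_1},\dots,x_k^{g_k})$. Then \[\alpha(\Gamma_G)=\alpha(\Gamma_{G_1})\cdots\alpha(\Gamma_{G_k}).\]
   Context: For a permutation group $G$ acting on a set, the derangement graph $\Gamma_G$ has vertex set $G$, with $\sigma,\pi$ adjacent iff $\sigma\pi^{ -1}$ has no fixed point. $\alpha(X)$ denotes the maximum size of an independent set in a graph $X$. -}

module Defs where

open import Level using (0ℓ)
open import Data.Nat using (ℕ; zero; suc; _*_; _≤_; NonZero)
open import Data.Fin using (Fin; zero; suc)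
open import Data.Unit using (⊤; tt)
open import Data.Product using (Σ; ∃; _×_; _,_; proj₁; proj₂)
open import Data.List using (List; length)
open import Data.List.Relation.Unary.All using (All)
open import Data.List.Relation.Unary.AllPairs using (AllPairs)
open import Function.Bundles using (_↔_; Inverse)
open import Relation.Nullary using (¬_)
open import Relation.Binary.PropositionalEquality using (_≡_)

Perm : Set → Set
Perm A = A ↔ A

module _ {A : Set} where
  open Inverse

  _≈ₚ_ : Perm A → Perm A → Set
  σ ≈ₚ π = ∀ x → to σ x ≡ to π x

  record IsPermGroup (G : Perm A → Set) : Set where
    field
      resp-≈  : ∀ σ π → σ ≈ₚ π → G σ → G π
      has-id  : Σ (Perm A) λ τ → G τ × (∀ x → to τ x ≡ x)
      closed-∘ : ∀ σ π → G σ → G π →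
                 Σ (Perm A) λ τ → G τ × (∀ x → to τ x ≡ to π (to σ x))
      closed-⁻¹ : ∀ σ → G σ →
                 Σ (Perm A) λ τ → G τ × (∀ x → to τ x ≡ from σ x)

  -- σπ⁻¹ has a fixed point (right action: x^(σπ⁻¹) = (x^σ)^(π⁻¹))
  HasFixedPoint-σπ⁻¹ : Perm A → Perm A → Set
  HasFixedPoint-σπ⁻¹ σ π = ∃ λ x → from π (to σ x) ≡ x

  -- In the derangement graph Γ_G (vertex set G, σ ~ π iff σπ⁻¹ is fixed-point-free),
  -- a list S of vertices is an independent set (listed without repetition) iff
  -- all entries lie in G, entries are pairwise distinct, and no two distinct
  -- entries are adjacent, i.e. σπ⁻¹ has a fixed point.
  IsIndependent : (G : Perm A → Set) → List (Perm A) → Set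
  IsIndependent G S =
      All G S
    × AllPairs (λ σ π → ¬ (σ ≈ₚ π)) S
    × AllPairs HasFixedPoint-σπ⁻¹ S

  IsIndependenceNumber : (G : Perm A → Set) → ℕ → Set
  IsIndependenceNumber G m =
      (Σ (List (Perm A)) λ S → IsIndependent G S × length S ≡ m)
    × (∀ S → IsIndependent G S → length S ≤ m)

Ω : (k : ℕ) → (Fin k → ℕ) → Set
Ω zero    n = ⊤
Ω (suc k) n = Fin (n zero) × Ω k (λ i → n (suc i))

actΩ : (k : ℕ) (n : Fin k → ℕ) → ((i : Fin k) → Fin (n i) → Fin (n i)) → Ω k n → Ω k n
actΩ zero    n g x        = tt
actΩ (suc k) n g (y , ys) = g zero y , actΩ k (λ i → n (suc i)) (λ i → g (suc i)) ys

DirectProduct : (k : ℕ) (n : Fin k → ℕ) → ((i : Fin k) → Perm (Fin (n i)) → Set) →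
                Perm (Ω k n) → Set
DirectProduct k n G g =
  Σ ((i : Fin k) → Perm (Fin (n i))) λ gs →
      (∀ i → G i (gs i))
    × (∀ x → Inverse.to g x ≡ actΩ k n (λ i → Inverse.to (gs i)) x)

∏ : (k : ℕ) → (Fin k → ℕ) → ℕ
∏ zero    m = 1
∏ (suc k) m = m zero * ∏ k (λ i → m (suc i))

-- σ and π are non-adjacent in Γ_G iff they agree at some point, and (g₁,…,g_k), (h₁,…,h_k)
-- agree at some point of Ω iff every gᵢ agrees with hᵢ somewhere. So an independent set of Γ_G
-- is a clique for the componentwise conjunction of the relations "agree somewhere", and such
-- clique numbers multiply. A product of cliques is a clique; conversely, a clique of pairs
-- uses at most α(Γ_{G₁}) pairwise distinct first coordinates (they form an independent set of
-- Γ_{G₁}), and the second coordinates over any one of them form an independent set of Γ_{G₂}.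
module Submission where

open import Defs
open import Data.Nat using (ℕ; NonZero)
open import Data.Fin using (Fin)

open import Level using (0ℓ)
open import Data.Nat using (zero; suc; _+_; _*_; _≤_; z≤n; s≤s)
open import Data.Nat.Properties
  using (≤-refl; ≤-trans; ≤-reflexive; +-comm; +-assoc; +-suc; +-identityʳ; +-monoˡ-≤; *-monoˡ-≤;
         module ≤-Reasoning)
open import Data.Fin using (zero; suc)
import Data.Fin.Properties as Fin
open import Data.Unit using (tt)
open import Data.Empty using (⊥-elim)
open import Data.Product using (Σ; ∃; _×_; _,_; proj₁; proj₂)
open import Data.List using (List; []; _∷_; length; map; filter; _++_; cartesianProduct)
open import Data.List.Properties using (length-++; length-map; length-filter)
open import Data.List.Membership.Propositional using (_∈_)
open import Data.List.Relation.Unary.Any using (here; there)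
open import Data.List.Relation.Unary.All as All using (All; []; _∷_)
import Data.List.Relation.Unary.All.Properties as All
open import Data.List.Relation.Unary.AllPairs as AllPairs using (AllPairs; []; _∷_)
import Data.List.Relation.Unary.AllPairs.Properties as AllPairs
open import Function using (_∘_; id)
open import Function.Bundles using (Inverse; mk↔ₛ′)
open import Relation.Nullary using (¬_; yes; no)
open import Relation.Unary using (Pred; Decidable)
open import Relation.Unary.Properties using (∁?)
open import Relation.Binary using (Rel; Reflexive; Symmetric; IsEquivalence)
import Relation.Binary as B
open import Relation.Binary.PropositionalEquality
  using (_≡_; refl; sym; trans; cong; cong₂; setoid)

open Inverse

length-filter+filter-∁ : {A : Set} {P : Pred A 0ℓ} (P? : Decidable P) (xs : List A) →
                         length xs ≡ length (filter P? xs) + length (filter (∁? P?) xs)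
length-filter+filter-∁ P? [] = refl
length-filter+filter-∁ P? (x ∷ xs) with P? x
... | yes _ = cong suc (length-filter+filter-∁ P? xs)
... | no _  = trans (cong suc (length-filter+filter-∁ P? xs)) (sym (+-suc _ _))

length-cartesianProduct : {A B : Set} (xs : List A) (ys : List B) →
                          length (cartesianProduct xs ys) ≡ length xs * length ys
length-cartesianProduct [] ys = refl
length-cartesianProduct (x ∷ xs) ys = begin
  length (map (x ,_) ys ++ cartesianProduct xs ys)           ≡⟨ length-++ (map (x ,_) ys) ⟩
  length (map (x ,_) ys) + length (cartesianProduct xs ys)   ≡⟨ cong₂ _+_ (length-map (x ,_) ys)
                                                                          (length-cartesianProduct xs ys) ⟩
  length ys + length xs * length ys                          ∎
  where open Relation.Binary.PropositionalEquality.≡-Reasoning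

AllPairs-lookup : {A : Set} {R : Rel A 0ℓ} → Reflexive R → Symmetric R →
                  ∀ {xs x y} → AllPairs R xs → x ∈ xs → y ∈ xs → R x y
AllPairs-lookup refl′ sym′ (_ ∷ _)   (here refl) (here refl) = refl′
AllPairs-lookup refl′ sym′ (Rx ∷ _)  (here refl) (there y∈)  = All.lookup Rx y∈
AllPairs-lookup refl′ sym′ (Rx ∷ _)  (there x∈)  (here refl) = sym′ (All.lookup Rx x∈)
AllPairs-lookup refl′ sym′ (_ ∷ Rxs) (there x∈)  (there y∈)  = AllPairs-lookup refl′ sym′ Rxs x∈ y∈

AllPairs-mapWithin : {A : Set} {Q : Pred A 0ℓ} {R R′ : Rel A 0ℓ} →
                     (∀ {a b} → Q a → Q b → R a b → R′ a b) →
                     ∀ {xs} → All Q xs → AllPairs R xs → AllPairs R′ xs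
AllPairs-mapWithin f []       []         = []
AllPairs-mapWithin f (q ∷ qs) (Rx ∷ Rxs) =
  All.zipWith (λ (q′ , Rxy) → f q q′ Rxy) (qs , Rx) ∷ AllPairs-mapWithin f qs Rxs

AllPairs-cartesianProduct⁺ : {A B : Set} {R : Rel (A × B) 0ℓ} (xs : List A) (ys : List B) →
  (∀ {x} → x ∈ xs → AllPairs (λ y y′ → R (x , y) (x , y′)) ys) →
  AllPairs (λ x x′ → ∀ {y y′} → y ∈ ys → y′ ∈ ys → R (x , y) (x′ , y′)) xs →
  AllPairs R (cartesianProduct xs ys)
AllPairs-cartesianProduct⁺ [] ys fibre across = []
AllPairs-cartesianProduct⁺ (x ∷ xs) ys fibre (Rx ∷ Rxs) =
  AllPairs.++⁺ (AllPairs.map⁺ (fibre (here refl)))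
               (AllPairs-cartesianProduct⁺ xs ys (fibre ∘ there) Rxs)
               (All.map⁺ (All.tabulate λ y∈ →
                 All.cartesianProduct⁺ (setoid _) (setoid _) xs ys λ x′∈ y′∈ →
                   All.lookup Rx x′∈ y∈ y′∈))

-- _≈_ is "same vertex" and _∼_ is "may lie in a common independent set"; for Γ_G these are
-- extensional equality and "σπ⁻¹ has a fixed point".
record CompatibilityStructure : Set₁ where
  field
    Carrier : Set
    Member  : Carrier → Set
    _≈_     : Carrier → Carrier → Set
    _∼_     : Carrier → Carrier → Set

  IsClique : List Carrier → Set
  IsClique L = All Member L × AllPairs (λ a b → ¬ a ≈ b) L × AllPairs _∼_ L

  HasCliqueNumber : ℕ → Set
  HasCliqueNumber m =
    (Σ (List Carrier) λ L → IsClique L × length L ≡ m) × (∀ L → IsClique L → length L ≤ m)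

  IsClique-filter⁺ : {P : Pred Carrier 0ℓ} (P? : Decidable P) → ∀ {L} → IsClique L → IsClique (filter P? L)
  IsClique-filter⁺ P? (members , distinct , compatible) =
    All.filter⁺ P? members , AllPairs.filter⁺ P? distinct , AllPairs.filter⁺ P? compatible

open CompatibilityStructure using (HasCliqueNumber)

record IsCompatibilityStructure (S : CompatibilityStructure) : Set where
  open CompatibilityStructure S
  field
    ≈-isEquivalence : IsEquivalence _≈_
    _≈?_            : B.Decidable _≈_
    ∼-refl          : Reflexive _∼_
    ∼-sym           : Symmetric _∼_

-- Maps defined on members only: the map from the direct product to tuples of components
-- needs the membership proof.
record Morphism (S T : CompatibilityStructure) : Set where
  private
    module S = CompatibilityStructure S
    module T = CompatibilityStructure T
  field
    apply   : ∀ x → S.Member x → T.Carrier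
    member  : ∀ x p → T.Member (apply x p)
    reflect : ∀ x p y q → apply x p T.≈ apply y q → x S.≈ y
    compat  : ∀ x p y q → x S.∼ y → apply x p T.∼ apply y q

  mapMembers : ∀ {L} → All S.Member L → List T.Carrier
  mapMembers []       = []
  mapMembers (p ∷ ps) = apply _ p ∷ mapMembers ps

  length-mapMembers : ∀ {L} (ps : All S.Member L) → length (mapMembers ps) ≡ length L
  length-mapMembers []       = refl
  length-mapMembers (p ∷ ps) = cong suc (length-mapMembers ps)

  mapMembers-member : ∀ {L} (ps : All S.Member L) → All T.Member (mapMembers ps)
  mapMembers-member []       = []
  mapMembers-member (p ∷ ps) = member _ p ∷ mapMembers-member ps

  module _ {R : Rel S.Carrier 0ℓ} {R′ : Rel T.Carrier 0ℓ}
           (preserves : ∀ x p y q → R x y → R′ (apply x p) (apply y q)) where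

    mapMembers-All : ∀ {x} (p : S.Member x) {L} (ps : All S.Member L) →
                     All (R x) L → All (R′ (apply x p)) (mapMembers ps)
    mapMembers-All p []       []         = []
    mapMembers-All p (q ∷ qs) (Rxy ∷ Rx) = preserves _ p _ q Rxy ∷ mapMembers-All p qs Rx

    mapMembers-AllPairs : ∀ {L} (ps : All S.Member L) → AllPairs R L → AllPairs R′ (mapMembers ps)
    mapMembers-AllPairs []       []         = []
    mapMembers-AllPairs (p ∷ ps) (Rx ∷ Rxs) = mapMembers-All p ps Rx ∷ mapMembers-AllPairs ps Rxs

  mapMembers-clique : ∀ {L} → (c : S.IsClique L) → T.IsClique (mapMembers (proj₁ c))
  mapMembers-clique (ps , distinct , compatible) =
    mapMembers-member ps ,
    mapMembers-AllPairs (λ x p y q x≉y fx≈fy → x≉y (reflect x p y q fx≈fy)) ps distinct ,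
    mapMembers-AllPairs compat ps compatible

HasCliqueNumber-transport : ∀ {S T} → Morphism S T → Morphism T S → ∀ {m} →
                            HasCliqueNumber T m → HasCliqueNumber S m
HasCliqueNumber-transport {S} {T} f g ((L , c , |L|≡m) , bound) =
  (G.mapMembers (proj₁ c) , G.mapMembers-clique c , trans (G.length-mapMembers (proj₁ c)) |L|≡m) ,
  λ L′ c′ → ≤-trans (≤-reflexive (sym (F.length-mapMembers (proj₁ c′))))
                    (bound _ (F.mapMembers-clique c′))
  where
  module F = Morphism f
  module G = Morphism g

_⊗_ : CompatibilityStructure → CompatibilityStructure → CompatibilityStructure
S ⊗ T = record
  { Carrier = S.Carrier × T.Carrier
  ; Member  = λ (a , b) → S.Member a × T.Member b
  ; _≈_     = λ (a , b) (a′ , b′) → a S.≈ a′ × b T.≈ b′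
  ; _∼_     = λ (a , b) (a′ , b′) → a S.∼ a′ × b T.∼ b′
  }
  where
  module S = CompatibilityStructure S
  module T = CompatibilityStructure T

module _ (S T : CompatibilityStructure) (isS : IsCompatibilityStructure S)
         (∼ᵀ-refl : Reflexive (CompatibilityStructure._∼_ T))
         (∼ᵀ-sym : Symmetric (CompatibilityStructure._∼_ T)) where
  private
    module S = CompatibilityStructure S
    module T = CompatibilityStructure T
    module ST = CompatibilityStructure (S ⊗ T)
    module ≈ˢ = IsEquivalence (IsCompatibilityStructure.≈-isEquivalence isS)
  open IsCompatibilityStructure isS using (_≈?_; ∼-refl; ∼-sym)

  cartesianProduct-clique : ∀ {L₁ L₂} → S.IsClique L₁ → T.IsClique L₂ →
                            ST.IsClique (cartesianProduct L₁ L₂)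
  cartesianProduct-clique {L₁} {L₂} (members₁ , distinct₁ , compatible₁)
                                    (members₂ , distinct₂ , compatible₂) =
    All.cartesianProduct⁺ (setoid _) (setoid _) L₁ L₂
      (λ x∈ y∈ → All.lookup members₁ x∈ , All.lookup members₂ y∈) ,
    AllPairs-cartesianProduct⁺ L₁ L₂
      (λ _ → AllPairs.map (λ y≉y′ → y≉y′ ∘ proj₂) distinct₂)
      (AllPairs.map (λ x≉x′ {_} {_} _ _ → x≉x′ ∘ proj₁) distinct₁) ,
    AllPairs-cartesianProduct⁺ L₁ L₂
      (λ _ → AllPairs.map (∼-refl ,_) compatible₂)
      (AllPairs.map (λ x∼x′ {_} {_} y∈ y′∈ → x∼x′ , AllPairs-lookup ∼ᵀ-refl ∼ᵀ-sym compatible₂ y∈ y′∈)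
                    compatible₁)

  SameFirst? : (a : S.Carrier) → Decidable (λ (z : ST.Carrier) → a S.≈ proj₁ z)
  SameFirst? a z = a ≈? proj₁ z

  fibre-clique : ∀ {x y L} → ST.IsClique ((x , y) ∷ L) →
                 T.IsClique (map proj₂ ((x , y) ∷ filter (SameFirst? x) L))
  fibre-clique {x} {y} {L} (p ∷ ps , d ∷ ds , c ∷ cs) =
    All.map⁺ (All.map proj₂ (p ∷ All.filter⁺ (SameFirst? x) ps)) ,
    AllPairs.map⁺ (AllPairs-mapWithin (λ x≈a x≈b a≉b b≈ → a≉b (≈ˢ.trans (≈ˢ.sym x≈a) x≈b , b≈))
                    (≈ˢ.refl ∷ All.all-filter (SameFirst? x) L)
                    (All.filter⁺ (SameFirst? x) d ∷ AllPairs.filter⁺ (SameFirst? x) ds)) ,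
    AllPairs.map⁺ (AllPairs.map proj₂
                    (All.filter⁺ (SameFirst? x) c ∷ AllPairs.filter⁺ (SameFirst? x) cs))

  FreshFor : S.Carrier → ST.Carrier → Set
  FreshFor a (x , _) = ¬ a S.≈ x × a S.∼ x

  module _ {m₁ m₂ : ℕ} (α₁ : S.HasCliqueNumber m₁) (α₂ : T.HasCliqueNumber m₂) where

    -- K collects the first coordinates of the part of the clique consumed so far; each of
    -- them accounted for at most m₂ elements. The fuel N allows recursion on a filtered tail.
    clique-bound : (N : ℕ) (L : List ST.Carrier) → length L ≤ N → ST.IsClique L →
                   (K : List S.Carrier) → S.IsClique K → All (λ a → All (FreshFor a) L) K →
                   length L + length K * m₂ ≤ m₁ * m₂
    clique-bound N [] _ _ K cK _ = *-monoˡ-≤ m₂ (proj₂ α₁ K cK)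
    clique-bound (suc N) ((x , y) ∷ L) (s≤s |L|≤N) cL@(p ∷ ps , _ ∷ ds , c ∷ cs)
                 K (pK , dK , cK) fresh =
      begin
        suc (length L) + length K * m₂
          ≡⟨ cong (λ l → suc l + length K * m₂) (length-filter+filter-∁ (SameFirst? x) L) ⟩
        suc (length F + length R) + length K * m₂
          ≤⟨ +-monoˡ-≤ (length K * m₂) (+-monoˡ-≤ (length R) |x∷F|≤m₂) ⟩
        m₂ + length R + length K * m₂
          ≡⟨ cong (_+ length K * m₂) (+-comm m₂ (length R)) ⟩
        length R + m₂ + length K * m₂
          ≡⟨ +-assoc (length R) m₂ (length K * m₂) ⟩
        length R + suc (length K) * m₂
          ≤⟨ clique-bound N R (≤-trans (length-filter (∁? (SameFirst? x)) L) |L|≤N)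
                          (ST.IsClique-filter⁺ (∁? (SameFirst? x)) (ps , ds , cs))
                          (x ∷ K) x∷K-clique fresh′ ⟩
        m₁ * m₂ ∎
      where
      open ≤-Reasoning
      F R : List ST.Carrier
      F = filter (SameFirst? x) L
      R = filter (∁? (SameFirst? x)) L

      |x∷F|≤m₂ : suc (length F) ≤ m₂
      |x∷F|≤m₂ = ≤-trans (≤-reflexive (sym (length-map proj₂ ((x , y) ∷ F))))
                         (proj₂ α₂ _ (fibre-clique cL))

      x∷K-clique : S.IsClique (x ∷ K)
      x∷K-clique = proj₁ p ∷ pK ,
                   All.map (λ fr x≈a → proj₁ (All.head fr) (≈ˢ.sym x≈a)) fresh ∷ dK ,
                   All.map (λ fr → ∼-sym (proj₂ (All.head fr))) fresh ∷ cK

      fresh′ : All (λ a → All (FreshFor a) R) (x ∷ K)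
      fresh′ = All.zipWith id (All.all-filter (∁? (SameFirst? x)) L ,
                               All.filter⁺ (∁? (SameFirst? x)) (All.map proj₁ c))
             ∷ All.map (All.filter⁺ (∁? (SameFirst? x)) ∘ All.tail) fresh

    HasCliqueNumber-⊗ : ST.HasCliqueNumber (m₁ * m₂)
    HasCliqueNumber-⊗ =
      (let (L₁ , c₁ , |L₁|≡m₁) , _ = α₁
           (L₂ , c₂ , |L₂|≡m₂) , _ = α₂
       in cartesianProduct L₁ L₂ , cartesianProduct-clique c₁ c₂ ,
          trans (length-cartesianProduct L₁ L₂) (cong₂ _*_ |L₁|≡m₁ |L₂|≡m₂)) ,
      λ L c → ≤-trans (≤-reflexive (sym (+-identityʳ (length L))))
                      (clique-bound (length L) L ≤-refl c [] ([] , [] , []) [])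

⨂ : (k : ℕ) → (Fin k → CompatibilityStructure) → CompatibilityStructure
⨂ k S = record
  { Carrier = (i : Fin k) → Carrier (S i)
  ; Member  = λ xs → ∀ i → Member (S i) (xs i)
  ; _≈_     = λ xs ys → ∀ i → _≈_ (S i) (xs i) (ys i)
  ; _∼_     = λ xs ys → ∀ i → _∼_ (S i) (xs i) (ys i)
  }
  where open CompatibilityStructure

consᶠ : ∀ {k} {B : Fin (suc k) → Set} → B zero → ((i : Fin k) → B (suc i)) →
        (i : Fin (suc k)) → B i
consᶠ b bs zero    = b
consᶠ b bs (suc i) = bs i

module _ {k : ℕ} (S : Fin (suc k) → CompatibilityStructure) where
  private
    module S i = CompatibilityStructure (S i)

  ⨂-uncons : Morphism (⨂ (suc k) S) (S zero ⊗ ⨂ k (S ∘ suc))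
  ⨂-uncons = record
    { apply   = λ xs _ → xs zero , xs ∘ suc
    ; member  = λ _ p → p zero , p ∘ suc
    ; reflect = λ _ _ _ _ (x≈y , xs≈ys) → consᶠ x≈y xs≈ys
    ; compat  = λ _ _ _ _ xs∼ys → xs∼ys zero , xs∼ys ∘ suc
    }

  ⨂-cons : Morphism (S zero ⊗ ⨂ k (S ∘ suc)) (⨂ (suc k) S)
  ⨂-cons = record
    { apply   = λ (x , xs) _ → consᶠ x xs
    ; member  = λ _ (p , ps) → member p ps
    ; reflect = λ _ _ _ _ e → e zero , e ∘ suc
    ; compat  = λ _ _ _ _ (x∼y , xs∼ys) → compat x∼y xs∼ys
    }
    where
    member : ∀ {x xs} → S.Member zero x → (∀ i → S.Member (suc i) (xs i)) →
             ∀ i → S.Member i (consᶠ {B = S.Carrier} x xs i)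
    member p ps zero    = p
    member p ps (suc i) = ps i
    compat : ∀ {x xs y ys} → S._∼_ zero x y → (∀ i → S._∼_ (suc i) (xs i) (ys i)) →
             ∀ i → S._∼_ i (consᶠ {B = S.Carrier} x xs i) (consᶠ {B = S.Carrier} y ys i)
    compat x∼y xs∼ys zero    = x∼y
    compat x∼y xs∼ys (suc i) = xs∼ys i

HasCliqueNumber-⨂ : (k : ℕ) (S : Fin k → CompatibilityStructure) →
                    (∀ i → IsCompatibilityStructure (S i)) →
                    (m : Fin k → ℕ) → (∀ i → HasCliqueNumber (S i) (m i)) →
                    HasCliqueNumber (⨂ k S) (∏ k m)
HasCliqueNumber-⨂ zero S isS m α = ((λ ()) ∷ [] , ((λ ()) ∷ [] , [] ∷ [] , [] ∷ []) , refl) , bound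
  where
  bound : ∀ L → CompatibilityStructure.IsClique (⨂ zero S) L → length L ≤ 1
  bound []          _                         = z≤n
  bound (_ ∷ [])    _                         = s≤s z≤n
  bound (_ ∷ _ ∷ _) (_ , (x≉y ∷ _) ∷ _ , _) = ⊥-elim (x≉y (λ ()))
HasCliqueNumber-⨂ (suc k) S isS m α =
  HasCliqueNumber-transport (⨂-uncons S) (⨂-cons S)
    (HasCliqueNumber-⊗ (S zero) (⨂ k (S ∘ suc)) (isS zero)
      (λ i → ∼-refl (isS (suc i))) (λ xs∼ys i → ∼-sym (isS (suc i)) (xs∼ys i))
      (α zero) (HasCliqueNumber-⨂ k (S ∘ suc) (isS ∘ suc) (m ∘ suc) (α ∘ suc)))
  where open IsCompatibilityStructure

Coincide : {A B : Set} → (A → B) → (A → B) → Set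
Coincide f g = ∃ λ x → f x ≡ g x

module _ {A : Set} where

  derangementStructure : (Perm A → Set) → CompatibilityStructure
  derangementStructure G = record
    { Carrier = Perm A ; Member = G ; _≈_ = _≈ₚ_ ; _∼_ = HasFixedPoint-σπ⁻¹ }

  hasFixedPoint⇒coincide : ∀ {σ π : Perm A} → HasFixedPoint-σπ⁻¹ σ π → Coincide (to σ) (to π)
  hasFixedPoint⇒coincide {σ} {π} (x , σπ⁻¹x≡x) =
    x , trans (sym (strictlyInverseˡ π (to σ x))) (cong (to π) σπ⁻¹x≡x)

  coincide⇒hasFixedPoint : ∀ {σ π : Perm A} → Coincide (to σ) (to π) → HasFixedPoint-σπ⁻¹ σ π
  coincide⇒hasFixedPoint {σ} {π} (x , σx≡πx) = x , trans (cong (from π) σx≡πx) (strictlyInverseʳ π x)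

  hasFixedPoint-refl : A → Reflexive HasFixedPoint-σπ⁻¹
  hasFixedPoint-refl x {σ} = coincide⇒hasFixedPoint {σ} {σ} (x , refl)

  hasFixedPoint-sym : Symmetric HasFixedPoint-σπ⁻¹
  hasFixedPoint-sym {σ} {π} σ∼π =
    let x , σx≡πx = hasFixedPoint⇒coincide {σ} {π} σ∼π in coincide⇒hasFixedPoint {π} {σ} (x , sym σx≡πx)

pointFin : ∀ {n} → NonZero n → Fin n
pointFin {suc n} _ = zero

derangementStructure-isCompatibilityStructure : ∀ {n} → NonZero n → (G : Perm (Fin n) → Set) →
                                                IsCompatibilityStructure (derangementStructure G)
derangementStructure-isCompatibilityStructure n≢0 G = record
  { ≈-isEquivalence = record
    { refl  = λ _ → refl
    ; sym   = λ σ≈π x → sym (σ≈π x)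
    ; trans = λ σ≈π π≈ρ x → trans (σ≈π x) (π≈ρ x)
    }
  ; _≈?_   = λ σ π → Fin.all? λ x → to σ x Fin.≟ to π x
  ; ∼-refl = λ {σ} → hasFixedPoint-refl (pointFin n≢0) {x = σ}
  ; ∼-sym  = λ {σ} {π} → hasFixedPoint-sym {x = σ} {π}
  }

Components : (k : ℕ) → (Fin k → ℕ) → Set
Components k n = (i : Fin k) → Fin (n i) → Fin (n i)

pointΩ : ∀ k n → (∀ i → NonZero (n i)) → Ω k n
pointΩ zero    n n≢0 = tt
pointΩ (suc k) n n≢0 = pointFin (n≢0 zero) , pointΩ k (n ∘ suc) (n≢0 ∘ suc)

actΩ-cong : ∀ k n {f g : Components k n} → (∀ i y → f i y ≡ g i y) → ∀ x → actΩ k n f x ≡ actΩ k n g x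
actΩ-cong zero    n f≗g tt       = refl
actΩ-cong (suc k) n f≗g (y , ys) = cong₂ _,_ (f≗g zero y) (actΩ-cong k (n ∘ suc) (f≗g ∘ suc) ys)

actΩ-injective : ∀ k n → (∀ i → NonZero (n i)) → {f g : Components k n} →
                 (∀ x → actΩ k n f x ≡ actΩ k n g x) → ∀ i y → f i y ≡ g i y
actΩ-injective (suc k) n n≢0 f≗g zero    y = cong proj₁ (f≗g (y , pointΩ k (n ∘ suc) (n≢0 ∘ suc)))
actΩ-injective (suc k) n n≢0 f≗g (suc i) y =
  actΩ-injective k (n ∘ suc) (n≢0 ∘ suc) (λ ys → cong proj₂ (f≗g (pointFin (n≢0 zero) , ys))) i y

actΩ-inverse : ∀ k n {f g : Components k n} → (∀ i y → f i (g i y) ≡ y) →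
               ∀ x → actΩ k n f (actΩ k n g x) ≡ x
actΩ-inverse zero    n fg≗id tt       = refl
actΩ-inverse (suc k) n fg≗id (y , ys) = cong₂ _,_ (fg≗id zero y) (actΩ-inverse k (n ∘ suc) (fg≗id ∘ suc) ys)

actΩ-coincide⁻ : ∀ k n {f g : Components k n} → Coincide (actΩ k n f) (actΩ k n g) →
                 ∀ i → Coincide (f i) (g i)
actΩ-coincide⁻ (suc k) n ((y , ys) , fx≡gx) zero    = y , cong proj₁ fx≡gx
actΩ-coincide⁻ (suc k) n ((y , ys) , fx≡gx) (suc i) = actΩ-coincide⁻ k (n ∘ suc) (ys , cong proj₂ fx≡gx) i

actΩ-coincide⁺ : ∀ k n {f g : Components k n} → (∀ i → Coincide (f i) (g i)) →
                 Coincide (actΩ k n f) (actΩ k n g)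
actΩ-coincide⁺ zero    n _ = tt , refl
actΩ-coincide⁺ (suc k) n coincide =
  let y , fy≡gy = coincide zero
      ys , fys≡gys = actΩ-coincide⁺ k (n ∘ suc) (coincide ∘ suc)
  in (y , ys) , cong₂ _,_ fy≡gy fys≡gys

actΩ-perm : ∀ k n → ((i : Fin k) → Perm (Fin (n i))) → Perm (Ω k n)
actΩ-perm k n σs = mk↔ₛ′ (actΩ k n (to ∘ σs)) (actΩ k n (from ∘ σs))
  (actΩ-inverse k n (strictlyInverseˡ ∘ σs))
  (actΩ-inverse k n (strictlyInverseʳ ∘ σs))

module _ (k : ℕ) (n : Fin k → ℕ) (G : (i : Fin k) → Perm (Fin (n i)) → Set) where
  private
    Γ-product = derangementStructure (DirectProduct k n G)
    Γ-components = ⨂ k (λ i → derangementStructure (G i))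

  directProduct-components : Morphism Γ-product Γ-components
  directProduct-components = record
    { apply   = λ _ (σs , _) → σs
    ; member  = λ _ (_ , σs∈G , _) → σs∈G
    ; reflect = λ _ (_ , _ , σ≗σs) _ (_ , _ , π≗πs) σs≈πs x →
        trans (σ≗σs x) (trans (actΩ-cong k n (λ i → σs≈πs i) x) (sym (π≗πs x)))
    ; compat  = λ σ (σs , _ , σ≗σs) π (πs , _ , π≗πs) σ∼π i →
        let x , σx≡πx = hasFixedPoint⇒coincide {σ = σ} {π} σ∼π
        in coincide⇒hasFixedPoint {σ = σs i} {πs i}
             (actΩ-coincide⁻ k n (x , trans (sym (σ≗σs x)) (trans σx≡πx (π≗πs x))) i)
    }

  components-directProduct : (∀ i → NonZero (n i)) → Morphism Γ-components Γ-product
  components-directProduct n≢0 = record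
    { apply   = λ σs _ → actΩ-perm k n σs
    ; member  = λ σs σs∈G → σs , σs∈G , λ _ → refl
    ; reflect = λ _ _ _ _ → actΩ-injective k n n≢0
    ; compat  = λ σs _ πs _ σs∼πs →
        coincide⇒hasFixedPoint {σ = actΩ-perm k n σs} {actΩ-perm k n πs}
          (actΩ-coincide⁺ k n (λ i → hasFixedPoint⇒coincide {σ = σs i} {πs i} (σs∼πs i)))
    }

lemma4p2 : (k : ℕ) (n : Fin k → ℕ) → (∀ i → NonZero (n i)) →
           (G : (i : Fin k) → Perm (Fin (n i)) → Set) →
           (∀ i → IsPermGroup (G i)) →
           (m : Fin k → ℕ) → (∀ i → IsIndependenceNumber (G i) (m i)) →
           IsIndependenceNumber (DirectProduct k n G) (∏ k m)
lemma4p2 k n n≢0 G _ m α =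
  HasCliqueNumber-transport (directProduct-components k n G) (components-directProduct k n G n≢0)
    (HasCliqueNumber-⨂ k (λ i → derangementStructure (G i))
      (λ i → derangementStructure-isCompatibilityStructure (n≢0 i) (G i)) m α)
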